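{- Let $l,t,s,x,n$ be integers with $t\ge l$, $2\le l\le x\le s$ and $n\ge 2s+1$. Then $$ex(n,\{K_{l,t},M_{s+1}\},x)\le (t-1)\binom{x}{l}+(l-1)n-\left\lceil\frac{x(l-1)}{2}\right\rceil+ex(2(s-x)+1,K_{l,t}).$$
   Context: All graphs are finite, simple and undirected. $ex(m,K_{l,t})$ is the maximum number of edges of an $m$-vertex graph with no $K_{l,t}$ subgraph ($K_{l,t}$: complete bipartite graph with parts of sizes $l,t$); $M_{s+1}$ is a matching of $s+1$ pairwise disjoint edges. For a graph $G$ with matching number at most $s$, let $\mathscr{X}(G)$ be the set of subsets $X\subseteq V(G)$ such that $|X|+\sum_{i=1}^m\lfloor |V(C_i)|/2\rfloor\le s$, where $C_1,\dots,C_m$ are the connected components of $G-X$, and let $x(G)=\max\{|X|: X\in\mathscr{X}(G)\}$. Let $\mathscr{G}_x$ be the set of graphs on $n$ vertices containing neither $K_{l,t}$ nor $M_{s+1}$ as a subgraph and with $x(G)=x$, and $ex(n,\{K_{l,t},M_{s+1}\},x)=\max_{G\in\mathscr{G}_x}e(G)$. -}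

module Defs where

open import Data.Nat using (ℕ; zero; suc; _+_; _*_; _∸_; _≤_; _<_; ⌊_/2⌋)
import Data.Nat as N
open import Data.Nat.ListAction using (sum)
open import Data.Bool.ListAction using (any)
open import Relation.Nullary.Decidable using (T?)
open import Data.Bool using (Bool; true; false; T; _∧_; _∨_; not; if_then_else_)
open import Data.Fin using (Fin; toℕ)
open import Data.Fin.Properties using (_≟_)
open import Data.List using (List; foldr; map; length; filter)
import Data.List as L
open import Data.Product using (Σ; _×_; _,_; ∃)
open import Function.Definitions using (Injective)
open import Relation.Binary.PropositionalEquality using (_≡_; _≢_)
open import Relation.Nullary using (¬_; does)

record Graph (n : ℕ) : Set where
  field
    adj    : Fin n → Fin n → Bool
    sym    : ∀ u v → adj u v ≡ adj v u
    irrefl : ∀ v → adj v v ≡ false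
open Graph public

countᵇ : {n : ℕ} → (Fin n → Bool) → ℕ
countᵇ {n} p = length (filter (λ v → T? (p v)) (L.allFin n))

_<ᵇ_ : {n : ℕ} → Fin n → Fin n → Bool
u <ᵇ v = toℕ u N.<ᵇ toℕ v

anyᵇ : {n : ℕ} → (Fin n → Bool) → Bool
anyᵇ {n} p = any p (L.allFin n)

sumF : {n : ℕ} → (Fin n → ℕ) → ℕ
sumF {n} f = sum (L.map f (L.allFin n))

e : {n : ℕ} → Graph n → ℕ
e {n} G = sumF (λ u → countᵇ (λ v → (u <ᵇ v) ∧ adj G u v))

VSet : ℕ → Set
VSet n = Fin n → Bool

∣_∣ : {n : ℕ} → VSet n → ℕ
∣ X ∣ = countᵇ X

ContainsKlt : {n : ℕ} → ℕ → ℕ → Graph n → Set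
ContainsKlt {n} l t G =
  Σ (Fin l → Fin n) λ a → Σ (Fin t → Fin n) λ b →
    Injective _≡_ _≡_ a × Injective _≡_ _≡_ b ×
    (∀ i j → a i ≢ b j) × (∀ i j → T (adj G (a i) (b j)))

ContainsMatching : {n : ℕ} → ℕ → Graph n → Set
ContainsMatching {n} k G =
  Σ (Fin k → Fin n) λ f → Σ (Fin k → Fin n) λ g →
    Injective _≡_ _≡_ f × Injective _≡_ _≡_ g ×
    (∀ i j → f i ≢ g j) × (∀ i → T (adj G (f i) (g i)))

-- Connectivity in G - X.  reach k u v : there is a walk from u to v of length ≤ k
-- all of whose vertices lie outside X (u is assumed outside X, checked in `conn`).
reach : {n : ℕ} → Graph n → VSet n → ℕ → Fin n → Fin n → Bool
reach G X zero    u v = does (u ≟ v)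
reach G X (suc k) u v = reach G X k u v ∨ anyᵇ (λ w → reach G X k u w ∧ adj G w v ∧ not (X v))

-- u and v lie in the same connected component of G - X (walks of length ≤ n suffice).
conn : {n : ℕ} → Graph n → VSet n → Fin n → Fin n → Bool
conn {n} G X u v = not (X u) ∧ not (X v) ∧ reach G X n u v

compSize : {n : ℕ} → Graph n → VSet n → Fin n → ℕ
compSize G X v = countᵇ (λ u → conn G X u v)

isRep : {n : ℕ} → Graph n → VSet n → Fin n → Bool
isRep G X v = not (X v) ∧ not (anyᵇ (λ u → (u <ᵇ v) ∧ conn G X u v))

-- Σ_i ⌊|V(C_i)|/2⌋ over the connected components C_1..C_m of G - X.
sumHalfComps : {n : ℕ} → Graph n → VSet n → ℕ
sumHalfComps G X = sumF (λ v → if isRep G X v then ⌊ compSize G X v /2⌋ else 0)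

InScrX : {n : ℕ} → ℕ → Graph n → VSet n → Set
InScrX s G X = ∣ X ∣ + sumHalfComps G X ≤ s

IsXofG : {n : ℕ} → ℕ → Graph n → ℕ → Set
IsXofG s G x = (Σ (VSet _) λ X → InScrX s G X × ∣ X ∣ ≡ x) × (∀ X → InScrX s G X → ∣ X ∣ ≤ x)

InGx : {n : ℕ} → ℕ → ℕ → ℕ → ℕ → Graph n → Set
InGx l t s x G = ¬ ContainsKlt l t G × ¬ ContainsMatching (suc s) G × IsXofG s G x

IsExKlt : ℕ → ℕ → ℕ → ℕ → Set
IsExKlt m l t k =
  (Σ (Graph m) λ H → ¬ ContainsKlt l t H × e H ≡ k) ×
  (∀ (H : Graph m) → ¬ ContainsKlt l t H → e H ≤ k)

-- Fix X ∈ 𝒳(G) with |X| = x and let Y be its complement. Counting degrees into X,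
-- 2e(G) = Σ_{v∈X} d_X(v) + 2 Σ_{v∈Y} d_X(v) + 2e(G[Y]), and d ≤ C(d,l) + l − 1 turns this into
-- 2e(G) + (l−1)x ≤ 2 Σ_v C(d_X(v),l) + 2(l−1)n + 2e(G[Y]). Since G has no K_{l,t}, every l-subset of X
-- has fewer than t common neighbours, so Σ_v C(d_X(v),l) ≤ (t−1) C(x,l). The components C_i of G[Y]
-- satisfy Σ ⌊|C_i|/2⌋ ≤ s − x, so merging one vertex of each component (these are pairwise
-- non-adjacent) yields a graph H on at most 2(s−x)+1 vertices with at least e(G[Y]) edges. H has no
-- K_{l,t} either: a copy with l, t ≥ 2 is connected, hence lies in one component, where the merged
-- vertex can be replaced by that component's own vertex. So e(G[Y]) ≤ ex(2(s−x)+1, K_{l,t}).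

module Submission where

open import Defs hiding (sym)
open import Data.Bool using (Bool; true; false; T; not; _∧_; _∨_; if_then_else_)
open import Data.Bool.Properties using (T-∧; T-∨) renaming (_≟_ to _≟ᵇ_)
open import Data.Empty using (⊥; ⊥-elim)
open import Data.Fin using (Fin; zero; suc; toℕ; fromℕ<; inject≤)
open import Data.Fin.Properties
  using (_≟_; toℕ-injective; toℕ-fromℕ<; toℕ-inject≤; toℕ<n; fromℕ<-injective; 0≢1+n; injective⇒≤;
         all?; ¬∀⟶∃¬)
open import Data.List using (List; []; _∷_; map; length; filter; _++_; cartesianProduct; lookup; allFin; foldr)
open import Data.List.Membership.Propositional using (_∈_; lose)
open import Data.List.Membership.Propositional.Properties
  using (∈-filter⁺; ∈-filter⁻; ∈-lookup; ∈-allFin; ∈-cartesianProduct⁺)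
open import Data.List.Properties
  using (length-filter; filter-some; length-++; filter-++; length-take; length-tabulate; map-cong)
open import Data.List.Relation.Binary.Sublist.Propositional using (_⊆_; []; _∷_; _∷ʳ_; ⊆-trans; minimum)
open import Data.List.Relation.Binary.Sublist.Propositional.Properties using (All-resp-⊆; filter-⊆; take-⊆)
open import Data.List.Relation.Unary.All as All using (All; []; _∷_)
open import Data.List.Relation.Unary.All.Properties using (all-filter)
open import Data.List.Relation.Unary.Any as Any using (here; there; index; satisfied)
open import Data.List.Relation.Unary.Any.Properties using (lookup-index; any⁺; any⁻)
open import Data.List.Relation.Unary.Unique.Propositional using (Unique; []; _∷_)
import Data.List.Relation.Unary.Unique.Propositional.Properties as Unique
open import Data.Nat using (ℕ; zero; suc; _+_; _*_; _∸_; _≤_; _<_; _<?_; z≤n; s≤s; ⌊_/2⌋; ⌈_/2⌉)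
import Data.Nat as ℕ
open import Data.Nat.Combinatorics using (_C_; nCk+nC[k+1]≡[n+1]C[k+1])
open import Data.Nat.ListAction using (sum)
open import Data.Nat.Properties hiding (_≟_; 0≢1+n)
open import Data.Nat.Solver using (module +-*-Solver)
open import Data.Product using (∃; _×_; _,_; proj₁; proj₂)
open import Data.Sum using (_⊎_; inj₁; inj₂)
open import Data.Unit using (tt)
open import Function using (_∘_; Equivalence)
open import Relation.Binary.Definitions using (tri<; tri≈; tri>)
open import Relation.Binary.PropositionalEquality
open import Relation.Nullary using (¬_; Dec; yes; no)
open import Relation.Nullary.Decidable using (T?; dec-true)
open import Relation.Nullary.Reflects using (ofʸ; ofⁿ)
open import Algebra.Properties.CommutativeSemigroup +-commutativeSemigroup using (interchange; xy∙z≈xz∙y)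

open +-*-Solver

private variable
  A B : Set

T-not⇒¬T : ∀ {b} → T (not b) → ¬ T b
T-not⇒¬T {false} _ ()

𝟙 : Bool → ℕ
𝟙 true  = 1
𝟙 false = 0

𝟙-∧ : ∀ a b → 𝟙 (a ∧ b) ≡ 𝟙 a * 𝟙 b
𝟙-∧ true  b = sym (+-identityʳ (𝟙 b))
𝟙-∧ false b = refl

∑ : (A → ℕ) → List A → ℕ
∑ f xs = sum (map f xs)

count : (A → Bool) → List A → ℕ
count p xs = length (filter (λ v → T? (p v)) xs)

∑-cong : {f g : A → ℕ} → (∀ a → f a ≡ g a) → (xs : List A) → ∑ f xs ≡ ∑ g xs
∑-cong f≗g []       = refl
∑-cong f≗g (x ∷ xs) = cong₂ _+_ (f≗g x) (∑-cong f≗g xs)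

∑-mono-≤ : {f g : A → ℕ} → (∀ a → f a ≤ g a) → (xs : List A) → ∑ f xs ≤ ∑ g xs
∑-mono-≤ f≤g []       = z≤n
∑-mono-≤ f≤g (x ∷ xs) = +-mono-≤ (f≤g x) (∑-mono-≤ f≤g xs)

∑-+ : (f g : A → ℕ) (xs : List A) → ∑ (λ a → f a + g a) xs ≡ ∑ f xs + ∑ g xs
∑-+ f g []       = refl
∑-+ f g (x ∷ xs) = trans (cong (f x + g x +_) (∑-+ f g xs)) (interchange (f x) (g x) (∑ f xs) (∑ g xs))

∑-*ˡ : (c : ℕ) (f : A → ℕ) (xs : List A) → ∑ (λ a → c * f a) xs ≡ c * ∑ f xs
∑-*ˡ c f []       = sym (*-zeroʳ c)
∑-*ˡ c f (x ∷ xs) = trans (cong (c * f x +_) (∑-*ˡ c f xs)) (sym (*-distribˡ-+ c (f x) _))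

∑-const : (c : ℕ) (xs : List A) → ∑ (λ _ → c) xs ≡ c * length xs
∑-const c []       = sym (*-zeroʳ c)
∑-const c (x ∷ xs) = trans (cong (c +_) (∑-const c xs)) (sym (*-suc c _))

∑-zero : (xs : List A) → ∑ (λ _ → 0) xs ≡ 0
∑-zero xs = ∑-const 0 xs

∑-comm : (F : A → B → ℕ) (xs : List A) (ys : List B) →
  ∑ (λ a → ∑ (F a) ys) xs ≡ ∑ (λ b → ∑ (λ a → F a b) xs) ys
∑-comm F []       ys = sym (∑-zero ys)
∑-comm F (x ∷ xs) ys = trans (cong (∑ (F x) ys +_) (∑-comm F xs ys))
                             (sym (∑-+ (F x) (λ b → ∑ (λ a → F a b) xs) ys))

∑-if : (q : A → Bool) (f : A → ℕ) (xs : List A) →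
  ∑ (λ a → if q a then f a else 0) xs ≡ ∑ f (filter (λ a → T? (q a)) xs)
∑-if q f [] = refl
∑-if q f (x ∷ xs) with q x
... | true  = cong (f x +_) (∑-if q f xs)
... | false = ∑-if q f xs

count≡∑𝟙 : (p : A → Bool) (xs : List A) → count p xs ≡ ∑ (λ a → 𝟙 (p a)) xs
count≡∑𝟙 p [] = refl
count≡∑𝟙 p (x ∷ xs) with p x
... | true  = cong suc (count≡∑𝟙 p xs)
... | false = count≡∑𝟙 p xs

count-filter : (p q : A → Bool) (xs : List A) →
  count q (filter (λ a → T? (p a)) xs) ≡ ∑ (λ a → 𝟙 (p a) * 𝟙 (q a)) xs
count-filter p q [] = refl
count-filter p q (x ∷ xs) with p x
... | false = count-filter p q xs
... | true with q x
...   | true  = cong suc (count-filter p q xs)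
...   | false = count-filter p q xs

count-++ : (p : A → Bool) (xs ys : List A) → count p (xs ++ ys) ≡ count p xs + count p ys
count-++ p xs ys = trans (cong length (filter-++ (λ a → T? (p a)) xs ys)) (length-++ (filter _ xs))

count-map : (p : B → Bool) (f : A → B) (xs : List A) → count p (map f xs) ≡ count (λ a → p (f a)) xs
count-map p f [] = refl
count-map p f (x ∷ xs) with p (f x)
... | true  = cong suc (count-map p f xs)
... | false = count-map p f xs

count-cartesianProduct : (P : A → B → Bool) (xs : List A) (ys : List B) →
  count (λ ab → P (proj₁ ab) (proj₂ ab)) (cartesianProduct xs ys) ≡ ∑ (λ a → count (P a) ys) xs
count-cartesianProduct P []       ys = refl
count-cartesianProduct P (x ∷ xs) ys =
  trans (count-++ _ (map (x ,_) ys) _)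
        (cong₂ _+_ (count-map _ (x ,_) ys) (count-cartesianProduct P xs ys))

count≤length : (p : A → Bool) (xs : List A) → count p xs ≤ length xs
count≤length p = length-filter (λ a → T? (p a))

count-pos : (p : A → Bool) {x : A} {xs : List A} → x ∈ xs → T (p x) → 0 < count p xs
count-pos p x∈xs px = filter-some (λ a → T? (p a)) (lose x∈xs px)

module _ {p q : A → Bool} (p⇒q : ∀ a → T (p a) → T (q a)) where

  count-mono-≤ : (xs : List A) → count p xs ≤ count q xs
  count-mono-≤ [] = z≤n
  count-mono-≤ (x ∷ xs) with p x | q x | p⇒q x
  ... | true  | true  | _   = s≤s (count-mono-≤ xs)
  ... | true  | false | p⇒q = ⊥-elim (p⇒q tt)
  ... | false | true  | _   = m≤n⇒m≤1+n (count-mono-≤ xs)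
  ... | false | false | _   = count-mono-≤ xs

  count-mono-< : {x : A} {xs : List A} → x ∈ xs → p x ≡ false → q x ≡ true → count p xs < count q xs
  count-mono-< {xs = y ∷ xs} (here refl) px qx rewrite px | qx = s≤s (count-mono-≤ xs)
  count-mono-< {xs = y ∷ xs} (there x∈xs) px qx with p y | q y | p⇒q y
  ... | true  | true  | _   = s≤s (count-mono-< x∈xs px qx)
  ... | true  | false | p⇒q = ⊥-elim (p⇒q tt)
  ... | false | true  | _   = m≤n⇒m≤1+n (count-mono-< x∈xs px qx)
  ... | false | false | _   = count-mono-< x∈xs px qx

lookup-injective : {xs : List A} → Unique xs → {i j : Fin (length xs)} → lookup xs i ≡ lookup xs j → i ≡ j
lookup-injective {xs = x ∷ xs} _          {zero}  {zero}  _  = refl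
lookup-injective {xs = x ∷ xs} (x∉xs ∷ _) {zero}  {suc j} eq = ⊥-elim (All.lookup x∉xs (∈-lookup j) eq)
lookup-injective {xs = x ∷ xs} (x∉xs ∷ _) {suc i} {zero}  eq = ⊥-elim (All.lookup x∉xs (∈-lookup i) (sym eq))
lookup-injective {xs = x ∷ xs} (_ ∷ uxs)  {suc i} {suc j} eq = cong suc (lookup-injective uxs eq)

⊆-unique : {xs ys : List A} → xs ⊆ ys → Unique ys → Unique xs
⊆-unique []         []           = []
⊆-unique (y ∷ʳ τ)   (_ ∷ uys)    = ⊆-unique τ uys
⊆-unique (refl ∷ τ) (y∉ys ∷ uys) = All-resp-⊆ τ y∉ys ∷ ⊆-unique τ uys

length-≤-injection : {xs : List A} {ys : List B} → Unique xs → (φ : A → B) →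
  (∀ {a} → a ∈ xs → φ a ∈ ys) →
  (∀ {a a′} → a ∈ xs → a′ ∈ xs → φ a ≡ φ a′ → a ≡ a′) →
  length xs ≤ length ys
length-≤-injection {xs = xs} {ys} uxs φ φ∈ φ-inj = injective⇒≤ {f = image-index} image-index-injective
  where
  image-index : Fin (length xs) → Fin (length ys)
  image-index i = index (φ∈ (∈-lookup i))

  image-index-injective : ∀ {i j} → image-index i ≡ image-index j → i ≡ j
  image-index-injective {i} {j} eq = lookup-injective uxs (φ-inj (∈-lookup i) (∈-lookup j) (begin
    φ (lookup xs i)             ≡⟨ lookup-index (φ∈ (∈-lookup i)) ⟩
    lookup ys (image-index i)      ≡⟨ cong (lookup ys) eq ⟩
    lookup ys (image-index j)      ≡⟨ lookup-index (φ∈ (∈-lookup j)) ⟨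
    φ (lookup xs j)             ∎))
    where open ≡-Reasoning

count-≤-injection : (p : A → Bool) (q : B → Bool) (φ : A → B) {xs : List A} {ys : List B} →
  Unique xs → (∀ {a} → T (p a) → φ a ∈ ys × T (q (φ a))) →
  (∀ {a a′} → T (p a) → T (p a′) → φ a ≡ φ a′ → a ≡ a′) → count p xs ≤ count q ys
count-≤-injection p q φ {xs} {ys} uxs φ∈ φ-inj =
  length-≤-injection (Unique.filter⁺ (λ a → T? (p a)) uxs) φ
    (λ a∈ → let pa = satisfies a∈ in ∈-filter⁺ (λ b → T? (q b)) (proj₁ (φ∈ pa)) (proj₂ (φ∈ pa)))
    (λ a∈ a′∈ → φ-inj (satisfies a∈) (satisfies a′∈))
  where
  satisfies : ∀ {a} → a ∈ filter (λ a → T? (p a)) xs → T (p a)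
  satisfies a∈ = proj₂ (∈-filter⁻ (λ a → T? (p a)) {xs = xs} a∈)

count≡1 : (p : A → Bool) {r : A} {xs : List A} → Unique xs → r ∈ xs → T (p r) →
  (∀ {a} → T (p a) → a ≡ r) → count p xs ≡ 1
count≡1 p {r} uxs r∈xs pr p⇒≡r = ≤-antisym
  (count-≤-injection p (λ _ → true) (λ a → a) {ys = r ∷ []} uxs (λ pa → here (p⇒≡r pa) , tt)
    (λ pa pa′ _ → trans (p⇒≡r pa) (sym (p⇒≡r pa′))))
  (count-pos p r∈xs pr)

count-none : (p : A → Bool) {xs : List A} → (∀ {a} → ¬ T (p a)) → count p xs ≡ 0
count-none p {[]}     _  = refl
count-none p {x ∷ xs} ¬p with p x in px
... | true  = ⊥-elim (¬p (subst T (sym px) tt))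
... | false = count-none p {xs} ¬p

C-pos : ∀ {n k} → k ≤ n → 0 < n C k
C-pos {n}     {zero}  _         = s≤s z≤n
C-pos {suc n} {suc k} (s≤s k≤n) =
  ≤-trans (C-pos k≤n) (≤-trans (m≤m+n (n C k) (n C suc k)) (≤-reflexive (nCk+nC[k+1]≡[n+1]C[k+1] n k)))

≤-C-suc : ∀ n k → n ≤ n C suc k + k
≤-C-suc zero    k = z≤n
≤-C-suc (suc n) k with k ≤? n
... | yes k≤n = begin
  suc n                             ≤⟨ s≤s (≤-C-suc n k) ⟩
  suc (n C suc k + k)               ≤⟨ +-monoˡ-≤ (n C suc k + k) (C-pos k≤n) ⟩
  n C k + (n C suc k + k)           ≡⟨ +-assoc (n C k) (n C suc k) k ⟨
  n C k + n C suc k + k             ≡⟨ cong (_+ k) (nCk+nC[k+1]≡[n+1]C[k+1] n k) ⟩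
  suc n C suc k + k                 ∎
  where open ≤-Reasoning
... | no k≰n = ≤-trans (≰⇒> k≰n) (m≤n+m k _)

-- Kővári–Sós–Turán counting

module KovariSosTuran (r : A → B → Bool) (t : ℕ) where

  deg : List A → B → ℕ
  deg as b = count (λ a → r a b) as

  Complete : List A → List B → Set
  Complete as bs = All (λ a → All (λ b → T (r a b)) bs) as

  KFree : ℕ → List A → List B → Set
  KFree l as bs = ∀ {as′ bs′} → as′ ⊆ as → bs′ ⊆ bs →
    length as′ ≡ l → length bs′ ≡ t → Complete as′ bs′ → ⊥

  private
    deg-∷ : ∀ a as l b → deg (a ∷ as) b C suc l ≡ deg as b C suc l + (if r a b then deg as b C l else 0)
    deg-∷ a as l b with r a b
    ... | true  = sym (trans (+-comm (deg as b C suc l) _) (nCk+nC[k+1]≡[n+1]C[k+1] (deg as b) l))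
    ... | false = sym (+-identityʳ _)

    length≤t∸1 : ∀ {as bs} → KFree 0 as bs → length bs ≤ t ∸ 1
    length≤t∸1 {as} {bs} free with t ≤? length bs
    ... | no t≰ = ≤-trans (<⇒≤pred (≰⇒> t≰)) (≤-reflexive (pred[m∸n]≡m∸[1+n] t 0))
    ... | yes t≤ = ⊥-elim (free (minimum as) (take-⊆ t bs) refl (trans (length-take t bs) (m≤n⇒m⊓n≡m t≤)) [])

  -- The left-hand side counts pairs (S, b) with S an l-element sublist of as joined to b,
  -- and no S is joined to t elements of bs.
  ∑-C-deg≤ : ∀ l as bs → KFree l as bs → ∑ (λ b → deg as b C l) bs ≤ (t ∸ 1) * (length as C l)
  ∑-C-deg≤ zero as bs free = begin
    ∑ (λ _ → 1) bs    ≡⟨ trans (∑-const 1 bs) (*-identityˡ _) ⟩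
    length bs         ≤⟨ length≤t∸1 free ⟩
    t ∸ 1             ≡⟨ *-identityʳ (t ∸ 1) ⟨
    (t ∸ 1) * 1       ∎
    where open ≤-Reasoning
  ∑-C-deg≤ (suc l) []       bs free = ≤-trans (≤-reflexive (∑-zero bs)) z≤n
  ∑-C-deg≤ (suc l) (a ∷ as) bs free = begin
    ∑ (λ b → deg (a ∷ as) b C suc l) bs
      ≡⟨ trans (∑-cong (deg-∷ a as l) bs) (∑-+ _ _ bs) ⟩
    ∑ (λ b → deg as b C suc l) bs + ∑ (λ b → if r a b then deg as b C l else 0) bs
      ≡⟨ cong (∑ (λ b → deg as b C suc l) bs +_) (∑-if (r a) _ bs) ⟩
    ∑ (λ b → deg as b C suc l) bs + ∑ (λ b → deg as b C l) (filter (λ b → T? (r a b)) bs)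
      ≤⟨ +-mono-≤ (∑-C-deg≤ (suc l) as bs without-a) (∑-C-deg≤ l as _ with-a) ⟩
    (t ∸ 1) * (length as C suc l) + (t ∸ 1) * (length as C l)
      ≡⟨ *-distribˡ-+ (t ∸ 1) _ _ ⟨
    (t ∸ 1) * (length as C suc l + length as C l)
      ≡⟨ cong ((t ∸ 1) *_) (trans (+-comm (length as C suc l) _) (nCk+nC[k+1]≡[n+1]C[k+1] (length as) l)) ⟩
    (t ∸ 1) * (length (a ∷ as) C suc l) ∎
    where
    open ≤-Reasoning
    without-a : KFree (suc l) as bs
    without-a τ = free (a ∷ʳ τ)
    with-a : KFree l as (filter (λ b → T? (r a b)) bs)
    with-a τ σ refl refl K =
      free (refl ∷ τ) (⊆-trans σ (filter-⊆ _ bs)) refl refl (All-resp-⊆ σ (all-filter _ bs) ∷ K)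

-- Degrees into a vertex set

∁ : {n : ℕ} → VSet n → VSet n
∁ X v = not (X v)

𝟙-split : ∀ b m → m ≡ 𝟙 b * m + 𝟙 (not b) * m
𝟙-split true  m = solve 1 (λ m → m := con 1 :* m :+ con 0 :* m) refl m
𝟙-split false m = solve 1 (λ m → m := con 0 :* m :+ con 1 :* m) refl m

module _ {n : ℕ} (G : Graph n) where

  private
    V : List (Fin n)
    V = allFin n

  𝟙adj≡𝟙[u<v]+𝟙[v<u] : ∀ u v →
    𝟙 (adj G u v) ≡ 𝟙 (u <ᵇ v ∧ adj G u v) + 𝟙 (v <ᵇ u ∧ adj G u v)
  𝟙adj≡𝟙[u<v]+𝟙[v<u] u v
    with toℕ u ℕ.<ᵇ toℕ v | <ᵇ-reflects-< (toℕ u) (toℕ v)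
       | toℕ v ℕ.<ᵇ toℕ u | <ᵇ-reflects-< (toℕ v) (toℕ u)
  ... | _ | ofʸ u<v | _ | ofʸ v<u = ⊥-elim (<-asym u<v v<u)
  ... | _ | ofʸ _   | _ | ofⁿ _   = sym (+-identityʳ _)
  ... | _ | ofⁿ _   | _ | ofʸ _   = refl
  ... | _ | ofⁿ u≮v | _ | ofⁿ v≮u
    rewrite toℕ-injective (≤-antisym (≮⇒≥ v≮u) (≮⇒≥ u≮v)) | irrefl G v = refl

  handshake : 2 * e G ≡ ∑ (λ u → ∑ (λ v → 𝟙 (adj G u v)) V) V
  handshake = sym (begin
    ∑ (λ u → ∑ (λ v → 𝟙 (adj G u v)) V) V
      ≡⟨ ∑-cong (λ u → trans (∑-cong (𝟙adj≡𝟙[u<v]+𝟙[v<u] u) V) (∑-+ (forward u) (backward u) V)) V ⟩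
    ∑ (λ u → ∑ (forward u) V + ∑ (backward u) V) V
      ≡⟨ ∑-+ _ _ V ⟩
    ∑ (λ u → ∑ (forward u) V) V + ∑ (λ u → ∑ (backward u) V) V
      ≡⟨ cong₂ _+_ (∑-cong (λ u → sym (count≡∑𝟙 _ V)) V)
                   (trans (∑-comm backward V V) (∑-cong backward≡ V)) ⟩
    e G + e G
      ≡⟨ cong (e G +_) (+-identityʳ (e G)) ⟨
    2 * e G ∎)
    where
    open ≡-Reasoning
    forward backward : Fin n → Fin n → ℕ
    forward  u v = 𝟙 (u <ᵇ v ∧ adj G u v)
    backward u v = 𝟙 (v <ᵇ u ∧ adj G u v)
    backward≡ : ∀ v → ∑ (λ u → backward u v) V ≡ count (λ u → v <ᵇ u ∧ adj G v u) V
    backward≡ v =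
      sym (trans (count≡∑𝟙 _ V) (∑-cong (λ u → cong (λ b → 𝟙 (v <ᵇ u ∧ b)) (Graph.sym G v u)) V))

  degIn : VSet n → Fin n → ℕ
  degIn S v = ∑ (λ u → 𝟙 (S u) * 𝟙 (adj G u v)) V

  arcsIn : VSet n → ℕ
  arcsIn S = ∑ (λ v → 𝟙 (S v) * degIn S v) V

  ∑-𝟙*degIn-comm : (S T : VSet n) →
    ∑ (λ v → 𝟙 (S v) * degIn T v) V ≡ ∑ (λ v → 𝟙 (T v) * degIn S v) V
  ∑-𝟙*degIn-comm S T = begin
    ∑ (λ v → 𝟙 (S v) * degIn T v) V
      ≡⟨ ∑-cong (λ v → sym (∑-*ˡ (𝟙 (S v)) _ V)) V ⟩
    ∑ (λ v → ∑ (λ u → 𝟙 (S v) * (𝟙 (T u) * 𝟙 (adj G u v))) V) V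
      ≡⟨ ∑-comm _ V V ⟩
    ∑ (λ u → ∑ (λ v → 𝟙 (S v) * (𝟙 (T u) * 𝟙 (adj G u v))) V) V
      ≡⟨ ∑-cong (λ u → ∑-cong (swap u) V) V ⟩
    ∑ (λ u → ∑ (λ v → 𝟙 (T u) * (𝟙 (S v) * 𝟙 (adj G v u))) V) V
      ≡⟨ ∑-cong (λ u → ∑-*ˡ (𝟙 (T u)) _ V) V ⟩
    ∑ (λ u → 𝟙 (T u) * degIn S u) V ∎
    where
    open ≡-Reasoning
    swap : ∀ u v → 𝟙 (S v) * (𝟙 (T u) * 𝟙 (adj G u v)) ≡ 𝟙 (T u) * (𝟙 (S v) * 𝟙 (adj G v u))
    swap u v rewrite Graph.sym G u v =
      solve 3 (λ s t a → s :* (t :* a) := t :* (s :* a)) refl (𝟙 (S v)) (𝟙 (T u)) (𝟙 (adj G v u))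

  2*e≡∑degIn+arcsIn : (X : VSet n) →
    2 * e G ≡ ∑ (λ v → 𝟙 (X v) * degIn X v + 2 * (𝟙 (∁ X v) * degIn X v)) V + arcsIn (∁ X)
  2*e≡∑degIn+arcsIn X = begin
    2 * e G
      ≡⟨ trans handshake (∑-comm _ V V) ⟩
    ∑ (λ v → ∑ (λ u → 𝟙 (adj G u v)) V) V
      ≡⟨ ∑-cong (λ v → trans (∑-cong (λ u → 𝟙-split (X u) (𝟙 (adj G u v))) V) (∑-+ _ _ V)) V ⟩
    ∑ (λ v → dX v + dY v) V
      ≡⟨ ∑-cong (λ v → regroup (X v) (dX v) (dY v)) V ⟩
    ∑ (λ v → (xx v + yx v + yy v) + xy v) V
      ≡⟨ trans (∑-+ _ xy V) (cong (∑ (λ v → xx v + yx v + yy v) V +_) (∑-𝟙*degIn-comm X (∁ X))) ⟩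
    ∑ (λ v → xx v + yx v + yy v) V + ∑ yx V
      ≡⟨ ∑-+ _ yx V ⟨
    ∑ (λ v → xx v + yx v + yy v + yx v) V
      ≡⟨ ∑-cong (λ v → solve 3 (λ a b c → a :+ b :+ c :+ b := (a :+ con 2 :* b) :+ c) refl
                               (xx v) (yx v) (yy v)) V ⟩
    ∑ (λ v → (xx v + 2 * yx v) + yy v) V
      ≡⟨ ∑-+ _ yy V ⟩
    ∑ (λ v → xx v + 2 * yx v) V + arcsIn (∁ X) ∎
    where
    open ≡-Reasoning
    dX dY xx yx xy yy : Fin n → ℕ
    dX = degIn X
    dY = degIn (∁ X)
    xx v = 𝟙 (X v) * dX v
    yx v = 𝟙 (∁ X v) * dX v
    xy v = 𝟙 (X v) * dY v
    yy v = 𝟙 (∁ X v) * dY v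
    regroup : ∀ b x y → x + y ≡ (𝟙 b * x + 𝟙 (not b) * x + 𝟙 (not b) * y) + 𝟙 b * y
    regroup b x y = begin
      x + y
        ≡⟨ cong₂ _+_ (𝟙-split b x) (𝟙-split b y) ⟩
      (𝟙 b * x + 𝟙 (not b) * x) + (𝟙 b * y + 𝟙 (not b) * y)
        ≡⟨ solve 4 (λ a c d f → (a :+ c) :+ (d :+ f) := (a :+ c :+ f) :+ d) refl
                   (𝟙 b * x) (𝟙 (not b) * x) (𝟙 b * y) (𝟙 (not b) * y) ⟩
      (𝟙 b * x + 𝟙 (not b) * x + 𝟙 (not b) * y) + 𝟙 b * y ∎

containsKlt : {n : ℕ} (G : Graph n) {as bs : List (Fin n)} → Unique as → Unique bs →
  All (λ a → All (λ b → T (adj G a b)) bs) as → ContainsKlt (length as) (length bs) G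
containsKlt G {as} {bs} uas ubs complete =
  lookup as , lookup bs , lookup-injective uas , lookup-injective ubs ,
  (λ i j eq → subst T (trans (cong (λ w → adj G w (lookup bs j)) eq) (irrefl G _)) (edge i j)) , edge
  where
  edge : ∀ i j → T (adj G (lookup as i) (lookup bs j))
  edge i j = All.lookup (All.lookup complete (∈-lookup i)) (∈-lookup j)

∑-C-degIn≤ : ∀ {n l t} (G : Graph n) (X : VSet n) → ¬ ContainsKlt l t G →
  ∑ (λ v → degIn G X v C l) (allFin n) ≤ (t ∸ 1) * (∣ X ∣ C l)
∑-C-degIn≤ {n} {l} {t} G X no-Klt = begin
  ∑ (λ v → degIn G X v C l) V
    ≡⟨ ∑-cong (λ v → cong (_C l) (count-filter X (λ u → adj G u v) V)) V ⟨
  ∑ (λ v → deg (filter X? V) v C l) V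
    ≤⟨ ∑-C-deg≤ l (filter X? V) V free ⟩
  (t ∸ 1) * (∣ X ∣ C l) ∎
  where
  open ≤-Reasoning
  open KovariSosTuran (adj G) t
  V : List (Fin n)
  V = allFin n
  X? : (v : Fin n) → Dec (T (X v))
  X? v = T? (X v)
  free : KFree l (filter X? V) V
  free τ σ |as|≡l |bs|≡t K = no-Klt (subst₂ (λ l t → ContainsKlt l t G) |as|≡l |bs|≡t
    (containsKlt G (⊆-unique (⊆-trans τ (filter-⊆ X? V)) (Unique.allFin⁺ n))
                   (⊆-unique σ (Unique.allFin⁺ n)) K))

degree-bound : ∀ b d l → 𝟙 b * d + 2 * (𝟙 (not b) * d) + l * 𝟙 b ≤ 2 * (d C suc l + l)
degree-bound true d l = begin
  1 * d + 2 * (0 * d) + l * 1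
    ≡⟨ solve 2 (λ d l → con 1 :* d :+ con 2 :* (con 0 :* d) :+ l :* con 1 := d :+ l) refl d l ⟩
  d + l
    ≤⟨ +-mono-≤ (≤-C-suc d l) (m≤n+m l (d C suc l)) ⟩
  (d C suc l + l) + (d C suc l + l)
    ≡⟨ cong (d C suc l + l +_) (+-identityʳ (d C suc l + l)) ⟨
  2 * (d C suc l + l) ∎
  where open ≤-Reasoning
degree-bound false d l = begin
  0 * d + 2 * (1 * d) + l * 0
    ≡⟨ solve 2 (λ d l → con 0 :* d :+ con 2 :* (con 1 :* d) :+ l :* con 0 := con 2 :* d) refl d l ⟩
  2 * d
    ≤⟨ *-monoʳ-≤ 2 (≤-C-suc d l) ⟩
  2 * (d C suc l + l) ∎
  where open ≤-Reasoning

2*e+l*∣X∣≤ : ∀ {n l t} (G : Graph n) (X : VSet n) → ¬ ContainsKlt (suc l) t G →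
  2 * e G + l * ∣ X ∣ ≤ 2 * ((t ∸ 1) * (∣ X ∣ C suc l) + l * n) + arcsIn G (∁ X)
2*e+l*∣X∣≤ {n} {l} {t} G X no-Klt = begin
  2 * e G + l * ∣ X ∣
    ≡⟨ cong₂ _+_ (2*e≡∑degIn+arcsIn G X) (trans (cong (l *_) (count≡∑𝟙 X V)) (sym (∑-*ˡ l _ V))) ⟩
  ∑ share V + arcsIn G (∁ X) + ∑ (λ v → l * 𝟙 (X v)) V
    ≡⟨ trans (xy∙z≈xz∙y (∑ share V) _ _)
             (cong (_+ arcsIn G (∁ X)) (sym (∑-+ share (λ v → l * 𝟙 (X v)) V))) ⟩
  ∑ (λ v → share v + l * 𝟙 (X v)) V + arcsIn G (∁ X)
    ≤⟨ +-monoˡ-≤ (arcsIn G (∁ X)) (∑-mono-≤ (λ v → degree-bound (X v) (degIn G X v) l) V) ⟩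
  ∑ (λ v → 2 * (degIn G X v C suc l + l)) V + arcsIn G (∁ X)
    ≡⟨ cong (_+ arcsIn G (∁ X)) (trans (∑-*ˡ 2 _ V) (cong (2 *_) ∑-C-deg+l)) ⟩
  2 * (∑ C-deg V + l * n) + arcsIn G (∁ X)
    ≤⟨ +-monoˡ-≤ (arcsIn G (∁ X)) (*-monoʳ-≤ 2 (+-monoˡ-≤ (l * n) (∑-C-degIn≤ G X no-Klt))) ⟩
  2 * ((t ∸ 1) * (∣ X ∣ C suc l) + l * n) + arcsIn G (∁ X) ∎
  where
  open ≤-Reasoning
  V : List (Fin n)
  V = allFin n
  C-deg : Fin n → ℕ
  C-deg v = degIn G X v C suc l
  share : Fin n → ℕ
  share v = 𝟙 (X v) * degIn G X v + 2 * (𝟙 (∁ X v) * degIn G X v)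
  ∑-C-deg+l : ∑ (λ v → C-deg v + l) V ≡ ∑ C-deg V + l * n
  ∑-C-deg+l = trans (∑-+ C-deg (λ _ → l) V)
    (cong (∑ C-deg V +_) (trans (∑-const l V) (cong (l *_) (length-tabulate {n = n} (λ v → v)))))

-- Walks and components of G − X

anyᵇ-intro : {n : ℕ} (p : Fin n → Bool) {w : Fin n} → T (p w) → T (anyᵇ p)
anyᵇ-intro {n} p {w} pw = any⁺ p (Any.map (λ { refl → pw }) (∈-allFin w))

anyᵇ-elim : {n : ℕ} (p : Fin n → Bool) → T (anyᵇ p) → ∃ λ w → T (p w)
anyᵇ-elim {n} p h = satisfied (any⁻ p (allFin n) h)

anyᵇ-cong : {n : ℕ} {p q : Fin n → Bool} → (∀ w → p w ≡ q w) → anyᵇ p ≡ anyᵇ q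
anyᵇ-cong {n} p≗q = cong (foldr _∨_ false) (map-cong p≗q (allFin n))

module Walks {n : ℕ} (G : Graph n) (X : VSet n) where

  Outside : Fin n → Set
  Outside v = T (not (X v))

  -- A record rather than a synonym for T (reach G X k u v), so that k, u and v can be inferred.
  record Walk (k : ℕ) (u v : Fin n) : Set where
    constructor walk
    field reaches : T (reach G X k u v)

  walk-suc : ∀ {k u v} → Walk k u v → Walk (suc k) u v
  walk-suc (walk h) = walk (Equivalence.from T-∨ (inj₁ h))

  walk-refl : ∀ u → Walk 0 u u
  walk-refl u = walk (subst T (sym (dec-true (u ≟ u) refl)) tt)

  walk-zero⁻ : ∀ {u v} → Walk 0 u v → u ≡ v
  walk-zero⁻ {u} {v} (walk h) with u ≟ v
  ... | yes u≡v = u≡v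

  walk-snoc : ∀ {k u w v} → Walk k u w → T (adj G w v) → Outside v → Walk (suc k) u v
  walk-snoc {k} {u} {w} {v} (walk h) w~v ov = walk (Equivalence.from T-∨ (inj₂
    (anyᵇ-intro (λ w → reach G X k u w ∧ adj G w v ∧ not (X v))
                (Equivalence.from T-∧ (h , Equivalence.from T-∧ (w~v , ov))))))

  walk-suc⁻ : ∀ {k u v} → Walk (suc k) u v → Walk k u v ⊎ ∃ λ w → Walk k u w × T (adj G w v) × Outside v
  walk-suc⁻ {k} {u} {v} (walk h) with Equivalence.to T-∨ h
  ... | inj₁ h′ = inj₁ (walk h′)
  ... | inj₂ h′ with anyᵇ-elim _ h′
  ...   | w , uw∧wv with Equivalence.to (T-∧ {reach G X k u w}) uw∧wv
  ...     | uw , wv = inj₂ (w , walk uw , Equivalence.to (T-∧ {adj G w v}) wv)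

  walk-+ : ∀ {k u v} j → Walk k u v → Walk (j + k) u v
  walk-+ zero    h = h
  walk-+ (suc j) h = walk-suc (walk-+ j h)

  walk-≤ : ∀ {k m u v} → k ≤ m → Walk k u v → Walk m u v
  walk-≤ {k} {m} {u} {v} k≤m h = subst (λ j → Walk j u v) (m∸n+n≡m k≤m) (walk-+ (m ∸ k) h)

  walk-++ : ∀ {j k u w v} → Walk j u w → Walk k w v → Walk (j + k) u v
  walk-++ {j} {zero} {u} uw wv rewrite walk-zero⁻ wv = subst (λ i → Walk i u _) (sym (+-identityʳ j)) uw
  walk-++ {j} {suc k} {u} {v = v} uw wv with walk-suc⁻ wv
  ... | inj₁ wv′                 = subst (λ i → Walk i u v) (sym (+-suc j k)) (walk-suc (walk-++ uw wv′))
  ... | inj₂ (x , wx , x~v , ov) = subst (λ i → Walk i u v) (sym (+-suc j k)) (walk-snoc (walk-++ uw wx) x~v ov)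

  walk-outside : ∀ {k u v} → Walk k u v → Outside u → Outside v
  walk-outside {zero}  uv ou rewrite walk-zero⁻ uv = ou
  walk-outside {suc k} uv ou with walk-suc⁻ uv
  ... | inj₁ uv′              = walk-outside uv′ ou
  ... | inj₂ (_ , _ , _ , ov) = ov

  walk-reverse : ∀ {k u v} → Outside u → Walk k u v → Walk k v u
  walk-reverse {zero}  ou uv rewrite walk-zero⁻ uv = walk-refl _
  walk-reverse {suc k} {u} ou uv with walk-suc⁻ uv
  ... | inj₁ uv′                 = walk-suc (walk-reverse ou uv′)
  ... | inj₂ (w , uw , w~v , ov) =
    walk-++ (walk-snoc (walk-refl _) (subst T (Graph.sym G w _) w~v) (walk-outside uw ou)) (walk-reverse ou uw)

  private
    V : List (Fin n)
    V = allFin n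

    record Stable (u : Fin n) (k : ℕ) : Set where
      constructor stable
      field reach-suc≡ : ∀ v → reach G X (suc k) u v ≡ reach G X k u v
    open Stable

    stable-suc : ∀ {u k} → Stable u k → Stable u (suc k)
    stable-suc (stable st) =
      stable λ v → cong₂ _∨_ (st v) (anyᵇ-cong (λ w → cong (_∧ (adj G w v ∧ not (X v))) (st w)))

    stable-+ : ∀ {u k} → Stable u k → ∀ j → Stable u (j + k)
    stable-+ st zero    = st
    stable-+ st (suc j) = stable-suc (stable-+ st j)

    reach-stable : ∀ {u k} → Stable u k → ∀ j v → reach G X (j + k) u v ≡ reach G X k u v
    reach-stable st zero    v = refl
    reach-stable st (suc j) v = trans (reach-suc≡ (stable-+ st j) v) (reach-stable st j v)

    reach-suc : ∀ {k u} v → T (reach G X k u v) → T (reach G X (suc k) u v)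
    reach-suc {k} {u} v h = Walk.reaches (walk-suc {k} {u} {v} (walk h))

    strict-implication : ∀ a b → (T a → T b) → b ≢ a → a ≡ false × b ≡ true
    strict-implication false true  _   _  = refl , refl
    strict-implication false false _   ne = ⊥-elim (ne refl)
    strict-implication true  true  _   ne = ⊥-elim (ne refl)
    strict-implication true  false a⇒b _  = ⊥-elim (a⇒b tt)

    -- The set reached from u in k steps grows with k until it stops growing for good,
    -- and it cannot grow n times.
    stable-or-growing : ∀ u k → Stable u k ⊎ k < count (reach G X k u) V
    stable-or-growing u zero = inj₂ (count-pos _ (∈-allFin u) (Walk.reaches (walk-refl u)))
    stable-or-growing u (suc k) with stable-or-growing u k
    ... | inj₁ st  = inj₁ (stable-suc st)
    ... | inj₂ k<r with all? (λ v → reach G X (suc k) u v ≟ᵇ reach G X k u v)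
    ...   | yes st = inj₁ (stable-suc (stable st))
    ...   | no ¬st =
      let v , ne = ¬∀⟶∃¬ n _ (λ v → reach G X (suc k) u v ≟ᵇ reach G X k u v) ¬st
          old , new = strict-implication _ _ (reach-suc {k} {u} v) ne
      in inj₂ (≤-trans (s≤s k<r) (count-mono-< (reach-suc {k} {u}) (∈-allFin v) old new))

    stable-at-n : ∀ u → Stable u n
    stable-at-n u with stable-or-growing u n
    ... | inj₁ st  = st
    ... | inj₂ n<r =
      ⊥-elim (<⇒≱ n<r (≤-trans (count≤length _ V) (≤-reflexive (length-tabulate {n = n} (λ v → v)))))

  walk-shorten : ∀ {k u v} → Walk k u v → Walk n u v
  walk-shorten {k} {u} {v} h with k ≤? n
  ... | yes k≤n = walk-≤ k≤n h
  ... | no  k≰n = walk (subst T (trans (cong (λ i → reach G X i u v) (sym (m∸n+n≡m (≰⇒≥ k≰n))))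
                                       (reach-stable (stable-at-n u) (k ∸ n) v)) (Walk.reaches h))

n≤2⌊n/2⌋+1 : ∀ n → n ≤ 2 * ⌊ n /2⌋ + 1
n≤2⌊n/2⌋+1 zero          = z≤n
n≤2⌊n/2⌋+1 (suc zero)    = s≤s z≤n
n≤2⌊n/2⌋+1 (suc (suc n)) =
  subst (suc (suc n) ≤_) (cong (_+ 1) (sym (*-suc 2 ⌊ n /2⌋))) (s≤s (s≤s (n≤2⌊n/2⌋+1 n)))

module Components {n : ℕ} (G : Graph n) (X : VSet n) where
  open Walks G X public

  private
    V : List (Fin n)
    V = allFin n

  record Connected (u v : Fin n) : Set where
    constructor connected
    field
      outsideˡ : Outside u
      outsideʳ : Outside v
      walkⁿ    : Walk n u v
  open Connected

  conn⇒Connected : ∀ {u v} → T (conn G X u v) → Connected u v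
  conn⇒Connected {u} h with Equivalence.to (T-∧ {not (X u)}) h
  ... | ou , h′ with Equivalence.to T-∧ h′
  ...   | ov , w = connected ou ov (walk w)

  Connected⇒conn : ∀ {u v} → Connected u v → T (conn G X u v)
  Connected⇒conn (connected ou ov (walk w)) = Equivalence.from T-∧ (ou , Equivalence.from T-∧ (ov , w))

  connected-refl : ∀ {u} → Outside u → Connected u u
  connected-refl ou = connected ou ou (walk-shorten (walk-refl _))

  connected-sym : ∀ {u v} → Connected u v → Connected v u
  connected-sym (connected ou ov w) = connected ov ou (walk-reverse ou w)

  connected-trans : ∀ {u w v} → Connected u w → Connected w v → Connected u v
  connected-trans (connected ou _ uw) (connected _ ov wv) = connected ou ov (walk-shorten (walk-++ uw wv))

  adjacent⇒connected : ∀ {u v} → Outside u → Outside v → T (adj G u v) → Connected u v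
  adjacent⇒connected ou ov u~v = connected ou ov (walk-shorten (walk-snoc (walk-refl _) u~v ov))

  IsRep : Fin n → Set
  IsRep v = T (isRep G X v)

  rep-outside : ∀ {v} → IsRep v → Outside v
  rep-outside h = proj₁ (Equivalence.to T-∧ h)

  rep-least : ∀ {u v} → IsRep v → Connected u v → ¬ toℕ u < toℕ v
  rep-least {u} {v} h uv u<v = T-not⇒¬T (proj₂ (Equivalence.to (T-∧ {not (X v)}) h))
    (anyᵇ-intro (λ w → (w <ᵇ v) ∧ conn G X w v) (Equivalence.from T-∧ (<⇒<ᵇ u<v , Connected⇒conn uv)))

  rep-unique : ∀ {r r′} → IsRep r → IsRep r′ → Connected r r′ → r ≡ r′
  rep-unique {r} {r′} h h′ rr′ with <-cmp (toℕ r) (toℕ r′)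
  ... | tri< r<r′ _ _ = ⊥-elim (rep-least h′ rr′ r<r′)
  ... | tri≈ _ r≡r′ _ = toℕ-injective r≡r′
  ... | tri> _ _ r′<r = ⊥-elim (rep-least h (connected-sym rr′) r′<r)

  reps-nonadjacent : ∀ {r r′} → IsRep r → IsRep r′ → ¬ T (adj G r r′)
  reps-nonadjacent {r} h h′ r~r′ with rep-unique h h′ (adjacent⇒connected (rep-outside h) (rep-outside h′) r~r′)
  ... | refl = subst T (irrefl G r) r~r′

  private
    rep-below : ∀ b {u} v → toℕ v < b → Connected v u → ∃ λ r → IsRep r × Connected r u
    rep-below (suc b) v v<b vu with anyᵇ (λ w → (w <ᵇ v) ∧ conn G X w v) in smaller
    ... | false = v , Equivalence.from T-∧ (outsideˡ vu , subst (T ∘ not) (sym smaller) tt) , vu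
    ... | true with anyᵇ-elim _ (subst T (sym smaller) tt)
    ...   | w , h with Equivalence.to T-∧ h
    ...     | w<v , wv =
      rep-below b w (≤-trans (<ᵇ⇒< _ _ w<v) (≤-pred v<b)) (connected-trans (conn⇒Connected wv) vu)

  rep-exists : ∀ {u} → Outside u → ∃ λ r → IsRep r × Connected r u
  rep-exists {u} ou = rep-below (suc (toℕ u)) u ≤-refl (connected-refl ou)

  count-reps-connected : ∀ u → count (λ v → isRep G X v ∧ conn G X u v) V ≡ 𝟙 (not (X u))
  count-reps-connected u = by-cases (X u) refl
    where
    p : Fin n → Bool
    p v = isRep G X v ∧ conn G X u v
    by-cases : ∀ b → X u ≡ b → count p V ≡ 𝟙 (not b)
    by-cases true  Xu = count-none p {V} λ {v} h →
      subst (T ∘ not) Xu (outsideˡ (conn⇒Connected (proj₂ (Equivalence.to (T-∧ {isRep G X v}) h))))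
    by-cases false Xu =
      let r , rep-r , ru = rep-exists (subst (T ∘ not) (sym Xu) tt) in
      count≡1 p (Unique.allFin⁺ n) (∈-allFin r) (Equivalence.from T-∧ (rep-r , Connected⇒conn (connected-sym ru)))
        λ {v} h → let rep-v , uv = Equivalence.to (T-∧ {isRep G X v}) h in
                  rep-unique rep-v rep-r (connected-trans (connected-sym (conn⇒Connected uv)) (connected-sym ru))

  ∑-compSize-reps : ∑ (λ v → 𝟙 (isRep G X v) * compSize G X v) V ≡ count (λ v → not (X v)) V
  ∑-compSize-reps = begin
    ∑ (λ v → 𝟙 (isRep G X v) * compSize G X v) V
      ≡⟨ ∑-cong (λ v → trans (cong (𝟙 (isRep G X v) *_) (count≡∑𝟙 (λ u → conn G X u v) V))
                             (sym (∑-*ˡ (𝟙 (isRep G X v)) (λ u → 𝟙 (conn G X u v)) V))) V ⟩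
    ∑ (λ v → ∑ (λ u → 𝟙 (isRep G X v) * 𝟙 (conn G X u v)) V) V
      ≡⟨ ∑-comm _ V V ⟩
    ∑ (λ u → ∑ (λ v → 𝟙 (isRep G X v) * 𝟙 (conn G X u v)) V) V
      ≡⟨ ∑-cong (λ u → trans (∑-cong (λ v → sym (𝟙-∧ (isRep G X v) (conn G X u v))) V)
                             (sym (count≡∑𝟙 _ V))) V ⟩
    ∑ (λ u → count (λ v → isRep G X v ∧ conn G X u v) V) V
      ≡⟨ trans (∑-cong count-reps-connected V) (sym (count≡∑𝟙 (λ v → not (X v)) V)) ⟩
    count (λ v → not (X v)) V ∎
    where open ≡-Reasoning

  nonRep : Fin n → Bool
  nonRep v = not (X v) ∧ not (isRep G X v)

  nonReps : List (Fin n)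
  nonReps = filter (λ v → T? (nonRep v)) V

  -- A component with c vertices has one representative and c − 1 ≤ 2⌊c/2⌋ other vertices.
  length-nonReps≤ : length nonReps ≤ 2 * sumHalfComps G X
  length-nonReps≤ = +-cancelʳ-≤ (count (isRep G X) V) _ _ (begin
    length nonReps + count (isRep G X) V
      ≡⟨ cong₂ _+_ (count≡∑𝟙 nonRep V) (count≡∑𝟙 (isRep G X) V) ⟩
    ∑ (λ v → 𝟙 (nonRep v)) V + ∑ (λ v → 𝟙 (isRep G X v)) V
      ≡⟨ trans (sym (∑-+ _ _ V)) (∑-cong (λ v → 𝟙-nonRep+𝟙-rep (X v) _) V) ⟩
    ∑ (λ v → 𝟙 (not (X v))) V
      ≡⟨ trans (sym (count≡∑𝟙 (λ v → not (X v)) V)) (sym ∑-compSize-reps) ⟩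
    ∑ (λ v → 𝟙 (isRep G X v) * compSize G X v) V
      ≤⟨ ∑-mono-≤ (λ v → halve (isRep G X v) (compSize G X v)) V ⟩
    ∑ (λ v → 2 * (if isRep G X v then ⌊ compSize G X v /2⌋ else 0) + 𝟙 (isRep G X v)) V
      ≡⟨ trans (∑-+ _ _ V) (cong₂ _+_ (∑-*ˡ 2 _ V) (sym (count≡∑𝟙 (isRep G X) V))) ⟩
    2 * sumHalfComps G X + count (isRep G X) V ∎)
    where
    open ≤-Reasoning
    𝟙-nonRep+𝟙-rep : ∀ x c → 𝟙 (not x ∧ not (not x ∧ c)) + 𝟙 (not x ∧ c) ≡ 𝟙 (not x)
    𝟙-nonRep+𝟙-rep true  c     = refl
    𝟙-nonRep+𝟙-rep false true  = refl
    𝟙-nonRep+𝟙-rep false false = refl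
    halve : ∀ b c → 𝟙 b * c ≤ 2 * (if b then ⌊ c /2⌋ else 0) + 𝟙 b
    halve true  c = subst (_≤ 2 * ⌊ c /2⌋ + 1) (sym (+-identityʳ c)) (n≤2⌊n/2⌋+1 c)
    halve false c = z≤n

-- Merging the representatives

data Node (n : ℕ) : Set where
  merged   : Node n
  vertex   : Fin n → Node n
  isolated : Node n

vertex-injective : ∀ {n} {u v : Fin n} → vertex u ≡ vertex v → u ≡ v
vertex-injective refl = refl

module Merge {n : ℕ} (G : Graph n) (X : VSet n) (M : ℕ) where
  open Components G X

  private
    V : List (Fin n)
    V = allFin n

  ∈-nonReps⁻ : ∀ {v} → v ∈ nonReps → Outside v × ¬ IsRep v
  ∈-nonReps⁻ {v} v∈
    with Equivalence.to (T-∧ {not (X v)}) (proj₂ (∈-filter⁻ (λ v → T? (nonRep v)) {xs = V} v∈))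
  ... | ov , ¬rep = ov , T-not⇒¬T ¬rep

  -- Node 0 of H stands for all representatives of components of G − X, node i+1 for the i-th
  -- vertex of nonReps, and the remaining nodes are isolated.
  node : Fin (suc M) → Node n
  node zero    = merged
  node (suc i) with toℕ i <? length nonReps
  ... | yes i<len = vertex (lookup nonReps (fromℕ< i<len))
  ... | no  _     = isolated

  unique-nonReps : Unique nonReps
  unique-nonReps = Unique.filter⁺ (λ v → T? (nonRep v)) (Unique.allFin⁺ n)

  node-suc : ∀ i (i<len : toℕ i < length nonReps) → node (suc i) ≡ vertex (lookup nonReps (fromℕ< i<len))
  node-suc i i<len with toℕ i <? length nonReps
  ... | yes _   = refl
  ... | no  i≮len = ⊥-elim (i≮len i<len)

  node-vertex⁻ : ∀ p {u} → node p ≡ vertex u → u ∈ nonReps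
  node-vertex⁻ (suc i) eq with toℕ i <? length nonReps
  node-vertex⁻ (suc i) refl | yes i<len = ∈-lookup (fromℕ< i<len)

  node-merged⁻ : ∀ p → node p ≡ merged → p ≡ zero
  node-merged⁻ zero    _ = refl
  node-merged⁻ (suc i) eq with toℕ i <? length nonReps
  node-merged⁻ (suc i) () | yes _
  node-merged⁻ (suc i) () | no  _

  node-injective : ∀ p q {u} → node p ≡ vertex u → node q ≡ vertex u → p ≡ q
  node-injective (suc i) (suc j) eq eq′ with toℕ i <? length nonReps | toℕ j <? length nonReps
  node-injective (suc i) (suc j) refl eq′ | yes i<len | yes j<len =
    cong suc (toℕ-injective (fromℕ<-injective _ _ i<len j<len
      (lookup-injective unique-nonReps (sym (vertex-injective eq′)))))

  repAdjacent : Fin n → Bool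
  repAdjacent v = anyᵇ (λ r → isRep G X r ∧ adj G r v)

  adjNode : Node n → Node n → Bool
  adjNode merged     (vertex v) = repAdjacent v
  adjNode (vertex u) merged     = repAdjacent u
  adjNode (vertex u) (vertex v) = adj G u v
  adjNode _          _          = false

  adjNode-sym : ∀ c d → adjNode c d ≡ adjNode d c
  adjNode-sym merged     merged     = refl
  adjNode-sym merged     (vertex v) = refl
  adjNode-sym merged     isolated   = refl
  adjNode-sym (vertex u) merged     = refl
  adjNode-sym (vertex u) (vertex v) = Graph.sym G u v
  adjNode-sym (vertex u) isolated   = refl
  adjNode-sym isolated   merged     = refl
  adjNode-sym isolated   (vertex v) = refl
  adjNode-sym isolated   isolated   = refl

  adjNode-irrefl : ∀ c → adjNode c c ≡ false
  adjNode-irrefl merged     = refl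
  adjNode-irrefl (vertex u) = irrefl G u
  adjNode-irrefl isolated   = refl

  H : Graph (suc M)
  H = record
    { adj    = λ p q → adjNode (node p) (node q)
    ; sym    = λ p q → adjNode-sym (node p) (node q)
    ; irrefl = λ p → adjNode-irrefl (node p)
    }

  private
    outside-node : ∀ p {u} → node p ≡ vertex u → Outside u
    outside-node p eq = proj₁ (∈-nonReps⁻ (node-vertex⁻ p eq))

    nonisolatedˡ : ∀ {c d} → T (adjNode c d) → c ≢ isolated
    nonisolatedˡ c~d refl = c~d

    nonisolatedʳ : ∀ c {d} → T (adjNode c d) → d ≢ isolated
    nonisolatedʳ c {d} c~d = nonisolatedˡ (subst T (adjNode-sym c d) c~d)

    adjacent-vertices : ∀ p q {u v} → node p ≡ vertex u → node q ≡ vertex v →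
      T (adjNode (node p) (node q)) → Connected u v
    adjacent-vertices p q eq eq′ p~q =
      adjacent⇒connected (outside-node p eq) (outside-node q eq′) (subst₂ (λ c d → T (adjNode c d)) eq eq′ p~q)

    sideˡ-nonisolated : ∀ {l t} (a : Fin l → Fin (suc M)) (b : Fin (suc t) → Fin (suc M)) →
      (∀ i j → T (adj H (a i) (b j))) → ∀ i → node (a i) ≢ isolated
    sideˡ-nonisolated a b edge i = nonisolatedˡ (edge i zero)

    sideʳ-nonisolated : ∀ {l t} (a : Fin (suc l) → Fin (suc M)) (b : Fin t → Fin (suc M)) →
      (∀ i j → T (adj H (a i) (b j))) → ∀ j → node (b j) ≢ isolated
    sideʳ-nonisolated a b edge j = nonisolatedʳ (node (a zero)) (edge zero j)

    vertex-among : ∀ {k} (a : Fin (suc (suc k)) → Fin (suc M)) → (∀ {i j} → a i ≡ a j → i ≡ j) →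
      (∀ i → node (a i) ≢ isolated) → ∃ λ i → ∃ λ u → node (a i) ≡ vertex u
    vertex-among a a-inj nonisolated with node (a zero) in e₀ | node (a (suc zero)) in e₁
    ... | vertex u | _        = zero , u , e₀
    ... | _        | vertex u = suc zero , u , e₁
    ... | isolated | _        = ⊥-elim (nonisolated zero e₀)
    ... | _        | isolated = ⊥-elim (nonisolated (suc zero) e₁)
    ... | merged   | merged   =
      ⊥-elim (0≢1+n (a-inj (trans (node-merged⁻ (a zero) e₀) (sym (node-merged⁻ (a (suc zero)) e₁)))))

  lift : Fin n → Node n → Fin n
  lift r (vertex u) = u
  lift r _          = r

  lift-injective : ∀ {r} → IsRep r → ∀ {p q} → node p ≢ isolated → node q ≢ isolated →
    lift r (node p) ≡ lift r (node q) → p ≡ q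
  lift-injective rep-r {p} {q} p≢iso q≢iso eq with node p in e | node q in e′
  ... | vertex u | vertex v = node-injective p q e (trans e′ (cong vertex (sym eq)))
  ... | merged   | merged   = trans (node-merged⁻ p e) (sym (node-merged⁻ q e′))
  ... | merged   | vertex v = ⊥-elim (proj₂ (∈-nonReps⁻ (node-vertex⁻ q e′)) (subst IsRep eq rep-r))
  ... | vertex u | merged   = ⊥-elim (proj₂ (∈-nonReps⁻ (node-vertex⁻ p e)) (subst IsRep (sym eq) rep-r))
  ... | isolated | _        = ⊥-elim (p≢iso refl)
  ... | merged   | isolated = ⊥-elim (q≢iso refl)
  ... | vertex _ | isolated = ⊥-elim (q≢iso refl)

  rep-adjacent : ∀ {r v} → IsRep r → Connected r v → T (repAdjacent v) → T (adj G r v)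
  rep-adjacent {v = v} rep-r rv h with anyᵇ-elim (λ r′ → isRep G X r′ ∧ adj G r′ v) h
  ... | r′ , h′ with Equivalence.to (T-∧ {isRep G X r′}) h′
  ...   | rep-r′ , r′~v
    with refl ← rep-unique rep-r′ rep-r
                  (connected-trans (adjacent⇒connected (rep-outside rep-r′) (Connected.outsideʳ rv) r′~v)
                                   (connected-sym rv))
    = r′~v

  lift-adjacent : ∀ {r} c d → IsRep r →
    (∀ {u} → c ≡ vertex u → Connected r u) → (∀ {v} → d ≡ vertex v → Connected r v) →
    T (adjNode c d) → T (adj G (lift r c) (lift r d))
  lift-adjacent     (vertex u) (vertex v) _     _  _  u~v = u~v
  lift-adjacent     merged     (vertex v) rep-r _  rv h   = rep-adjacent rep-r (rv refl) h
  lift-adjacent {r} (vertex u) merged     rep-r ru _  h   = subst T (Graph.sym G r u) (rep-adjacent rep-r (ru refl) h)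

  -- All vertex nodes of a copy of K_{l,t} in H lie in one component of G − X, and its representative
  -- can stand in for the merged node.
  ContainsKlt-H⇒G : ∀ {l t} → 2 ≤ l → 2 ≤ t → ContainsKlt l t H → ContainsKlt l t G
  ContainsKlt-H⇒G (s≤s (s≤s _)) (s≤s (s≤s _)) (a , b , a-inj , b-inj , _ , edge)
    with i₀ , u₀ , a-i₀ ← vertex-among a a-inj (sideˡ-nonisolated a b edge)
       | j₀ , v₀ , b-j₀ ← vertex-among b b-inj (sideʳ-nonisolated a b edge)
    with u₀~v₀ ← adjacent-vertices (a i₀) (b j₀) a-i₀ b-j₀ (edge i₀ j₀)
    with r , rep-r , r~u₀ ← rep-exists (Connected.outsideˡ u₀~v₀)
    = lift r ∘ node ∘ a , lift r ∘ node ∘ b ,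
      (λ {i} {j} → a-inj ∘ lift-injective rep-r {a i} {a j}
                             (sideˡ-nonisolated a b edge i) (sideˡ-nonisolated a b edge j)) ,
      (λ {i} {j} → b-inj ∘ lift-injective rep-r {b i} {b j}
                             (sideʳ-nonisolated a b edge i) (sideʳ-nonisolated a b edge j)) ,
      (λ i j eq → subst T (trans (cong (λ w → adj G w _) eq) (irrefl G _)) (edge′ i j)) ,
      edge′
    where
    a-connected : ∀ i {u} → node (a i) ≡ vertex u → Connected r u
    a-connected i eq = connected-trans (connected-trans r~u₀ u₀~v₀)
      (connected-sym (adjacent-vertices (a i) (b j₀) eq b-j₀ (edge i j₀)))
    b-connected : ∀ j {v} → node (b j) ≡ vertex v → Connected r v
    b-connected j eq = connected-trans r~u₀ (adjacent-vertices (a i₀) (b j) a-i₀ eq (edge i₀ j))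
    edge′ : ∀ i j → T (adj G (lift r (node (a i))) (lift r (node (b j))))
    edge′ i j = lift-adjacent (node (a i)) (node (b j)) rep-r (a-connected i) (b-connected j) (edge i j)

  rep⇒¬nonRep : ∀ {v} → IsRep v → ¬ T (nonRep v)
  rep⇒¬nonRep {v} rep nr = T-not⇒¬T (proj₂ (Equivalence.to (T-∧ {not (X v)}) nr)) rep

  outside-split : ∀ {v} → Outside v → T (nonRep v) ⊎ IsRep v
  outside-split {v} ov with isRep G X v
  ... | true  = inj₂ tt
  ... | false = inj₁ (Equivalence.from T-∧ (ov , tt))

  OutsideEdge : Fin n → Fin n → Set
  OutsideEdge u v = Outside u × Outside v × T (adj G u v)

  outsideEdge-sym : ∀ {u v} → OutsideEdge u v → OutsideEdge v u
  outsideEdge-sym {u} {v} (ou , ov , u~v) = ov , ou , subst T (Graph.sym G u v) u~v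

  private
    adjNode-at : ∀ p q {c d} → node p ≡ c → node q ≡ d → T (adjNode c d) → T (adjNode (node p) (node q))
    adjNode-at _ _ refl refl c~d = c~d

  module Embedding (enough : length nonReps ≤ M) where

    -- Inverse to `node` on vertices outside X; representatives go to the merged node.
    position : Fin n → Fin (suc M)
    position v with T? (nonRep v)
    ... | yes nr = suc (inject≤ (index (∈-filter⁺ (λ v → T? (nonRep v)) (∈-allFin v) nr)) enough)
    ... | no  _  = zero

    node-position-nonRep : ∀ {v} → T (nonRep v) → node (position v) ≡ vertex v
    node-position-nonRep {v} nr with T? (nonRep v)
    ... | no ¬nr = ⊥-elim (¬nr nr)
    ... | yes nr′ = trans (node-suc (inject≤ (index v∈) enough) k<len) (cong vertex (begin
      lookup nonReps (fromℕ< k<len)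
        ≡⟨ cong (lookup nonReps) (toℕ-injective (trans (toℕ-fromℕ< k<len) (toℕ-inject≤ (index v∈) enough))) ⟩
      lookup nonReps (index v∈)
        ≡⟨ lookup-index v∈ ⟨
      v ∎))
      where
      open ≡-Reasoning
      v∈ : v ∈ nonReps
      v∈ = ∈-filter⁺ (λ v → T? (nonRep v)) (∈-allFin v) nr′
      k<len : toℕ (inject≤ (index v∈) enough) < length nonReps
      k<len = subst (_< length nonReps) (sym (toℕ-inject≤ (index v∈) enough)) (toℕ<n (index v∈))

    position-zero : ∀ {v} → ¬ T (nonRep v) → position v ≡ zero
    position-zero {v} ¬nr with T? (nonRep v)
    ... | yes nr = ⊥-elim (¬nr nr)
    ... | no  _  = refl

    position-adjacent : ∀ {u v} → OutsideEdge u v → T (adj H (position u) (position v))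
    position-adjacent {u} {v} (ou , ov , u~v) with outside-split ou | outside-split ov
    ... | inj₁ nu | inj₁ nv = adjNode-at (position u) (position v) (node-position-nonRep nu) (node-position-nonRep nv) u~v
    ... | inj₂ ru | inj₁ nv = adjNode-at (position u) (position v)
      (cong node (position-zero (rep⇒¬nonRep ru))) (node-position-nonRep nv)
      (anyᵇ-intro (λ r → isRep G X r ∧ adj G r v) (Equivalence.from T-∧ (ru , u~v)))
    ... | inj₁ nu | inj₂ rv = adjNode-at (position u) (position v)
      (node-position-nonRep nu) (cong node (position-zero (rep⇒¬nonRep rv)))
      (anyᵇ-intro (λ r → isRep G X r ∧ adj G r u) (Equivalence.from T-∧ (rv , subst T (Graph.sym G u v) u~v)))
    ... | inj₂ ru | inj₂ rv = ⊥-elim (reps-nonadjacent ru rv u~v)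

    position-injective-nonRep : ∀ {v v′} → T (nonRep v) → position v ≡ position v′ → v ≡ v′
    position-injective-nonRep {v} {v′} nr eq = by-cases (T? (nonRep v′))
      where
      node-v≡node-v′ : node (position v) ≡ node (position v′)
      node-v≡node-v′ = cong node eq
      by-cases : Dec (T (nonRep v′)) → v ≡ v′
      by-cases (yes nr′) =
        vertex-injective (trans (sym (node-position-nonRep nr)) (trans node-v≡node-v′ (node-position-nonRep nr′)))
      by-cases (no ¬nr′)
        with () ← trans (sym (node-position-nonRep nr)) (trans node-v≡node-v′ (cong node (position-zero ¬nr′)))

    -- A representative endpoint of an edge is determined by the other endpoint, which is not one.
    position-injective-edge : ∀ {u v u′ v′} → OutsideEdge u v → OutsideEdge u′ v′ →
      position u ≡ position u′ → position v ≡ position v′ → u ≡ u′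
    position-injective-edge (ou , ov , u~v) (ou′ , ov′ , u′~v′) pu pv
      with outside-split ou | outside-split ou′ | outside-split ov
    ... | inj₁ nu | _        | _       = position-injective-nonRep nu pu
    ... | inj₂ _  | inj₁ nu′ | _       = sym (position-injective-nonRep nu′ (sym pu))
    ... | inj₂ ru | inj₂ _   | inj₂ rv = ⊥-elim (reps-nonadjacent ru rv u~v)
    ... | inj₂ ru | inj₂ ru′ | inj₁ nv with refl ← position-injective-nonRep nv pv =
      rep-unique ru ru′
        (connected-trans (adjacent⇒connected ou ov u~v) (connected-sym (adjacent⇒connected ou′ ov u′~v′)))

    arc : Fin n × Fin n → Bool
    arc (v , u) = not (X v) ∧ not (X u) ∧ adj G u v

    arc⁻ : ∀ {v u} → T (arc (v , u)) → OutsideEdge u v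
    arc⁻ {v} {u} h with Equivalence.to (T-∧ {not (X v)}) h
    ... | ov , h′ with Equivalence.to (T-∧ {not (X u)}) h′
    ...   | ou , u~v = ou , ov , u~v

    position² : Fin n × Fin n → Fin (suc M) × Fin (suc M)
    position² (v , u) = position v , position u

    position²-injective : ∀ {vu vu′} → T (arc vu) → T (arc vu′) → position² vu ≡ position² vu′ → vu ≡ vu′
    position²-injective {v , u} {v′ , u′} h h′ eq = cong₂ _,_
      (position-injective-edge (outsideEdge-sym (arc⁻ h)) (outsideEdge-sym (arc⁻ h′)) (cong proj₁ eq) (cong proj₂ eq))
      (position-injective-edge (arc⁻ h) (arc⁻ h′) (cong proj₂ eq) (cong proj₁ eq))

    arcsIn[∁X]≤2*e[H] : arcsIn G (∁ X) ≤ 2 * e H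
    arcsIn[∁X]≤2*e[H] = begin
      arcsIn G (∁ X)
        ≡⟨ ∑-cong (λ v → trans (sym (∑-*ˡ (𝟙 (∁ X v)) _ V))
                               (trans (∑-cong (𝟙-arc v) V) (sym (count≡∑𝟙 _ V)))) V ⟩
      ∑ (λ v → count (λ u → arc (v , u)) V) V
        ≡⟨ count-cartesianProduct (λ v u → arc (v , u)) V V ⟨
      count arc (cartesianProduct V V)
        ≤⟨ count-≤-injection arc (λ (p , q) → adj H p q) position²
             (Unique.cartesianProduct⁺ (Unique.allFin⁺ n) (Unique.allFin⁺ n))
             (λ h → ∈-cartesianProduct⁺ (∈-allFin _) (∈-allFin _) , position-adjacent (outsideEdge-sym (arc⁻ h)))
             position²-injective ⟩
      count (λ (p , q) → adj H p q) (cartesianProduct W W)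
        ≡⟨ count-cartesianProduct (adj H) W W ⟩
      ∑ (λ p → count (adj H p) W) W
        ≡⟨ ∑-cong (λ p → count≡∑𝟙 (adj H p) W) W ⟩
      ∑ (λ p → ∑ (λ q → 𝟙 (adj H p q)) W) W
        ≡⟨ handshake H ⟨
      2 * e H ∎
      where
      open ≤-Reasoning
      W : List (Fin (suc M))
      W = allFin (suc M)
      𝟙-arc : ∀ v u → 𝟙 (∁ X v) * (𝟙 (∁ X u) * 𝟙 (adj G u v)) ≡ 𝟙 (arc (v , u))
      𝟙-arc v u = sym (trans (𝟙-∧ (not (X v)) _) (cong (𝟙 (not (X v)) *_) (𝟙-∧ (not (X u)) _)))

m+n≤o⇒n≤o∸m : ∀ m {n o} → m + n ≤ o → n ≤ o ∸ m
m+n≤o⇒n≤o∸m m {n} {o} m+n≤o = m+n≤o⇒m≤o∸n n (subst (_≤ o) (+-comm m n) m+n≤o)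

halve-≤ : ∀ a m b → 2 * a + m ≤ 2 * b → a + ⌈ m /2⌉ ≤ b
halve-≤ a m b 2a+m≤2b = begin
  a + ⌈ m /2⌉                         ≤⟨ +-monoʳ-≤ a (⌈n/2⌉-mono m≤2[b∸a]) ⟩
  a + ⌈ (b ∸ a) + (b ∸ a) /2⌉         ≡⟨ cong (a +_) (n≡⌈n+n/2⌉ (b ∸ a)) ⟨
  a + (b ∸ a)                         ≡⟨ m+[n∸m]≡n a≤b ⟩
  b                                   ∎
  where
  open ≤-Reasoning
  a≤b : a ≤ b
  a≤b = *-cancelˡ-≤ 2 (m+n≤o⇒m≤o (2 * a) 2a+m≤2b)
  m≤2[b∸a] : m ≤ (b ∸ a) + (b ∸ a)
  m≤2[b∸a] = begin
    m                     ≤⟨ m+n≤o⇒n≤o∸m (2 * a) 2a+m≤2b ⟩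
    2 * b ∸ 2 * a         ≡⟨ *-distribˡ-∸ 2 b a ⟨
    2 * (b ∸ a)           ≡⟨ cong ((b ∸ a) +_) (+-identityʳ (b ∸ a)) ⟩
    (b ∸ a) + (b ∸ a)     ∎

-- Only some X ∈ 𝒳(G) with |X| = x is used: neither the maximality of x, nor M_{s+1}-freeness,
-- nor the bounds l ≤ x ≤ s and 2s + 1 ≤ n.
lemma3p4 : (l t s x n : ℕ) → l ≤ t → 2 ≤ l → l ≤ x → x ≤ s → suc (2 * s) ≤ n →
    (k : ℕ) → IsExKlt (suc (2 * (s ∸ x))) l t k →
    (G : Graph n) → InGx l t s x G →
    e G + ⌈ x * (l ∸ 1) /2⌉ ≤ (t ∸ 1) * (x C l) + (l ∸ 1) * n + k
lemma3p4 (suc l) t s .(∣ X ∣) n l≤t 2≤l _ _ _ k (_ , ex-bound) G (no-Klt , _ , (X , X∈𝒳 , refl) , _) =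
  halve-≤ (e G) (∣ X ∣ * l) ((t ∸ 1) * (∣ X ∣ C suc l) + l * n + k) (begin
    2 * e G + ∣ X ∣ * l
      ≡⟨ cong (2 * e G +_) (*-comm ∣ X ∣ l) ⟩
    2 * e G + l * ∣ X ∣
      ≤⟨ 2*e+l*∣X∣≤ G X no-Klt ⟩
    2 * ((t ∸ 1) * (∣ X ∣ C suc l) + l * n) + arcsIn G (∁ X)
      ≤⟨ +-monoʳ-≤ _ (≤-trans arcsIn[∁X]≤2*e[H] (*-monoʳ-≤ 2 e[H]≤k)) ⟩
    2 * ((t ∸ 1) * (∣ X ∣ C suc l) + l * n) + 2 * k
      ≡⟨ *-distribˡ-+ 2 ((t ∸ 1) * (∣ X ∣ C suc l) + l * n) k ⟨
    2 * ((t ∸ 1) * (∣ X ∣ C suc l) + l * n + k) ∎)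
  where
  open ≤-Reasoning
  open Components G X using (length-nonReps≤)
  open Merge G X (2 * (s ∸ ∣ X ∣))
  open Embedding (≤-trans length-nonReps≤ (*-monoʳ-≤ 2 (m+n≤o⇒n≤o∸m ∣ X ∣ X∈𝒳)))
  e[H]≤k : e H ≤ k
  e[H]≤k = ex-bound H (no-Klt ∘ ContainsKlt-H⇒G 2≤l (≤-trans 2≤l l≤t))
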